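{- Let $G=(V,E)$ be a directed graph with distinct vertices $s,t\in V$ such that $t$ is reachable from $s$, all edges having unit capacity. Then every ordering of $E$ produced by $\textsc{Quickest-Increment}$ is $2$-competitive, i.e. $f(S^{*}_{k})\leq2f(S^{\mathrm{A}}_{k})$ for all $k\in\{1,\dots,|E|\}$.
   Context: For $X\subseteq E$, $f(X)$ is the maximum value of an $s$-$t$-flow in $(V,X)$ with unit edge capacities. For $k\in\{1,\dots,|E|\}$, $S^{*}_{k}$ denotes a set $X\subseteq E$ with $|X|\leq k$ maximizing $f(X)$. Algorithm $\textsc{Quickest-Increment}$: it first appends the edges of a shortest (fewest edges) $s$-$t$-path, then repeatedly appends (in arbitrary order) a minimum-cardinality set of not yet chosen edges whose addition increases the maximum flow value of the chosen edge set by at least $1$, until the maximum flow value of $G$ is reached; remaining edges are appended arbitrarily. $S^{\mathrm{A}}_{k}$ denotes the set of the first $k$ edges of the resulting ordering. -}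

module Defs where

open import Data.Bool using (Bool; true; false; _∧_; _∨_; not; if_then_else_)
open import Data.Nat as ℕ using (ℕ; zero; suc; _≡ᵇ_)
open import Data.Integer as ℤ using (ℤ; +_; _-_; _⊔_)
open import Data.Fin as Fin using (Fin)
open import Data.Fin.Subset using (Subset; ⊥; ⊤; ⁅_⁆; _∪_; _∈_; _∉_; ∣_∣)
open import Data.List using (List; []; _∷_; _++_; length; map; foldr; allFin; filterᵇ; concat; take)
open import Data.List.Relation.Unary.Unique.Propositional using (Unique)
open import Data.List.Relation.Binary.Permutation.Propositional using (_↭_)
import Data.List.Membership.Propositional as LM
open import Data.Nat.ListAction using (sum)
open import Data.Bool.ListAction using (and)
open import Data.Vec using (Vec; []; _∷_)
open import Data.Product using (Σ; _×_; _,_)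
open import Function.Definitions using (Injective)
open import Relation.Binary.PropositionalEquality using (_≡_; _≢_)
open import Relation.Nullary.Decidable using (⌊_⌋)

record Digraph : Set where
  field
    V E  : ℕ
    tail : Fin E → Fin V
    head : Fin E → Fin V

-- G = (V,E) with E ⊆ V × V : no parallel edges (edge is determined by its endpoints)
Simple : Digraph → Set
Simple G = Injective _≡_ _≡_ (λ e → tail e , head e)
  where open Digraph G

allSubsets : (m : ℕ) → List (Subset m)
allSubsets zero    = [] ∷ []
allSubsets (suc m) = map (true ∷_) (allSubsets m) ++ map (false ∷_) (allSubsets m)

_⊆ᵇ_ : ∀ {m} → Subset m → Subset m → Bool
[] ⊆ᵇ [] = true
(a ∷ φ) ⊆ᵇ (b ∷ X) = (not a ∨ b) ∧ (φ ⊆ᵇ X)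

module _ (G : Digraph) where
  open Digraph G

  toSubset : List (Fin E) → Subset E
  toSubset = foldr (λ e S → ⁅ e ⁆ ∪ S) ⊥

  data Walk : Fin V → Fin V → List (Fin E) → Set where
    []  : ∀ {v} → Walk v v []
    _∷_ : ∀ {u w p} (e : Fin E) → tail e ≡ u → Walk (head e) w p → Walk u w (e ∷ p)

  SA : List (Fin E) → ℕ → Subset E
  SA ord k = toSubset (take k ord)

module _ (G : Digraph) (s t : Fin (Digraph.V G)) where
  open Digraph G

  member : Fin E → Subset E → Bool
  member e φ = Data.Vec.lookup φ e

  outDeg inDeg : Subset E → Fin V → ℕ
  outDeg φ v = sum (map (λ e → if member e φ ∧ ⌊ tail e Fin.≟ v ⌋ then 1 else 0) (allFin E))
  inDeg  φ v = sum (map (λ e → if member e φ ∧ ⌊ head e Fin.≟ v ⌋ then 1 else 0) (allFin E))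

  value : Subset E → ℤ
  value φ = + outDeg φ s - + inDeg φ s

  -- φ (set of edges carrying one unit) is an s-t-flow in (V,X) with unit capacities:
  -- capacity constraint φ ⊆ X, and flow conservation at every v ∉ {s,t}
  isFlow : Subset E → Subset E → Bool
  isFlow X φ = (φ ⊆ᵇ X) ∧ and (map (λ v → ⌊ v Fin.≟ s ⌋ ∨ ⌊ v Fin.≟ t ⌋ ∨ (inDeg φ v ≡ᵇ outDeg φ v)) (allFin V))

  -- f(X) : maximum value of an s-t-flow in (V,X) with unit capacities
  -- (integral 0/1 flows; by the integrality theorem this equals the real max-flow value;
  --  the zero flow is always feasible, so starting the maximum at 0 is harmless)
  f : Subset E → ℤ
  f X = foldr _⊔_ (+ 0) (map value (filterᵇ (isFlow X) (allSubsets E)))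

  ShortestPath : List (Fin E) → Set
  ShortestPath p = Walk G s t p × (∀ q → Walk G s t q → length p ℕ.≤ length q)

  -- the sequence of augmenting blocks chosen after the current chosen set C
  data Increments (C : Subset E) : List (List (Fin E)) → Set where
    stop : f C ≡ f ⊤ → Increments C []
    step : ∀ {bs} (b : List (Fin E))
         → f C ℤ.< f ⊤
         → (∀ e → e LM.∈ b → e ∉ C)
         → f C ℤ.+ + 1 ℤ.≤ f (C ∪ toSubset G b)
         → (∀ (B : Subset E) → (∀ e → e ∈ B → e ∉ C)
              → f C ℤ.+ + 1 ℤ.≤ f (C ∪ B) → length b ℕ.≤ ∣ B ∣)
         → Increments (C ∪ toSubset G b) bs
         → Increments C (b ∷ bs)

  IsOrdering : List (Fin E) → Set
  IsOrdering ord = Unique ord × (∀ e → e LM.∈ ord)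

  QuickestIncrement : List (Fin E) → Set
  QuickestIncrement ord =
    IsOrdering ord ×
    Σ (List (Fin E)) λ p → Σ (List (Fin E)) λ b₀ → Σ (List (List (Fin E))) λ bs → Σ (List (Fin E)) λ rest →
      ShortestPath p × (b₀ ↭ p) × Increments (toSubset G p) bs × (ord ≡ b₀ ++ concat bs ++ rest)

{-# OPTIONS --safe #-}
module Submission where

-- Let w = f(S^A_k) and suppose f(X) > 2w with |X| ≤ k. For C ⊆ S^A_k we have f(C) ≤ w, so a
-- maximum flow in X minus one in C is a residual flow of value at least w + 1. It splits into
-- w + 1 residual s-t paths whose edges outside C are disjoint and lie in X, so some set of at
-- most |X|/(w+1) edges outside C increases f(C). Hence every block chosen by Quickest-Increment
-- (the first one being a shortest path) has at most |X|/(w+1) edges as long as the chosen set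
-- lies in S^A_k. After c ≤ w blocks the chosen prefix therefore has at most (c+1)|X|/(w+1) ≤ |X|
-- ≤ k edges even with the next block. So all blocks stay inside S^A_k, and the chosen set, whose
-- value is at most w, would eventually reach f(E) ≥ f(X) > w.

open import Defs
open import Data.Bool using (Bool; true; false; _∧_; _∨_; not; if_then_else_; T; T?)
open import Data.Bool.Properties using (T-∧; ∧-zeroʳ)
open import Data.Bool.ListAction using (and)
open import Data.Empty using (⊥; ⊥-elim)
open import Data.Fin using (Fin; zero; suc; _≟_)
open import Data.Fin.Subset using (Subset; _∈_; _∉_; _⊆_; _∪_; ⁅_⁆; ∣_∣) renaming (⊥ to ∅)
open import Data.Fin.Subset.Properties using (∪-identityˡ; ⊆-min; drop-∷-⊆; ∉⊥; x∈⁅y⁆⇒x≡y; ⊆⊤; x∈⁅x⁆; x≢y⇒x∉⁅y⁆; x∈p∪q⁻; x∈p∪q⁺; p⊆q⇒∣p∣≤∣q∣)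
open import Data.List using (List; []; _∷_; _++_; map; foldr; filterᵇ; allFin; length; take; concat)
open import Data.List.Relation.Unary.Any using (here; there)
import Data.List.Membership.Propositional as List
open import Data.List.Relation.Binary.Subset.Propositional using () renaming (_⊆_ to _⊆ₗ_)
open import Data.List.Relation.Binary.Subset.Propositional.Properties using (∷⁺ʳ; xs⊆x∷xs)
open import Data.List.Relation.Unary.Unique.Propositional using (Unique)
open import Data.List.Relation.Unary.AllPairs using ([]; _∷_)
open import Data.List.Relation.Unary.All.Properties.Core using (¬Any⇒All¬; All¬⇒¬Any)
open import Data.List.Membership.Propositional.Properties using (∈-map⁺; ∈-map⁻; ∈-filter⁺; ∈-filter⁻; ∈-++⁺ˡ; ∈-++⁺ʳ; ∈-allFin; foldr-selective)
open import Data.Nat using (ℕ; zero; suc)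
open import Data.Product using (_×_; _,_; proj₁; proj₂; ∃)
import Data.Product as Product
open import Data.Sum using (_⊎_; inj₁; inj₂; reduce)
open import Data.Vec using (lookup; []; _∷_; here; there)
import Data.Vec as Vec
open import Data.Vec.Properties using (lookup∘tabulate; lookup-zipWith; lookup-replicate; []=⇒lookup; lookup⇒[]=)
open import Function using (_∘_; id; Equivalence)
open import Relation.Binary.PropositionalEquality using (_≡_; _≢_; refl; sym; trans; cong; cong₂; subst; subst₂; module ≡-Reasoning)
open import Relation.Nullary using (yes; no; ¬_; does)
open import Relation.Nullary.Decidable using (⌊_⌋; isYes≗does; dec-true; dec-false)

module FlowTheory where

  open import Data.Integer using (ℤ; +_; 0ℤ; 1ℤ; -1ℤ; _+_; _-_; -_; _*_; _≤_; _<_; _⊔_; +≤+; +<+) renaming (∣_∣ to ∣_∣ℤ; _≟_ to _≟ℤ_)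
  import Data.Integer.Properties as ℤ
  open import Data.Integer.Tactic.RingSolver using (solve-∀)
  import Data.Nat as ℕ
  import Data.Nat.Properties as ℕ
  import Data.Nat.ListAction as ℕ
  open import Data.List.Relation.Unary.All as All using (All)
  open import Data.List.Relation.Unary.All.Properties using (all⁺; all⁻)
  import Algebra.Properties.CommutativeMonoid.Sum as MonoidSum
  open MonoidSum ℤ.+-0-commutativeMonoid using (sum; sum-cong-≗; ∑-distrib-+; sum-replicate-zero)
  module ℕΣ = MonoidSum ℕ.+-0-commutativeMonoid

  ind : Bool → ℤ
  ind b = if b then 1ℤ else 0ℤ

  -- does rather than ⌊_⌋ (= isYes): does (suc i ≟ suc j) reduces to does (i ≟ j), which the
  -- inductive proofs about erase rely on.
  δ : ∀ {n} → Fin n → Fin n → ℤ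
  δ u v = ind (does (u ≟ v))

  δ-refl : ∀ {n} (u : Fin n) → δ u u ≡ 1ℤ
  δ-refl u = cong ind (dec-true (u ≟ u) refl)

  δ-≢ : ∀ {n} {u v : Fin n} → u ≢ v → δ u v ≡ 0ℤ
  δ-≢ {u = u} {v} u≢v = cong ind (dec-false (u ≟ v) u≢v)

  erase : ∀ {n} → (Fin n → ℤ) → Fin n → Fin n → ℤ
  erase g e i = if does (i ≟ e) then 0ℤ else g i

  erase-self : ∀ {n} (g : Fin n → ℤ) e → erase g e e ≡ 0ℤ
  erase-self g e rewrite dec-true (e ≟ e) refl = refl

  sum-erase : ∀ {n} (g : Fin n → ℤ) e → sum g ≡ sum (erase g e) + g e
  sum-erase g zero = trans (ℤ.+-comm (g zero) (sum (g ∘ suc))) (cong (_+ g zero) (sym (ℤ.+-identityˡ (sum (g ∘ suc)))))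
  sum-erase g (suc e) = trans (cong (_+_ (g zero)) (sum-erase (g ∘ suc) e)) (sym (ℤ.+-assoc (g zero) _ _))

  sum-neg : ∀ {n} (g : Fin n → ℤ) → sum (λ i → - g i) ≡ - sum g
  sum-neg {zero} g = refl
  sum-neg {suc n} g = trans (cong (_+_ (- g zero)) (sum-neg (g ∘ suc))) (sym (ℤ.neg-distrib-+ (g zero) _))

  positive-term : ∀ {n} (g : Fin n → ℤ) → 0ℤ < sum g → ∃ λ i → 0ℤ < g i
  positive-term {zero} g (+<+ ())
  positive-term {suc n} g 0<Σ with 0ℤ ℤ.<? g zero
  ... | yes 0<g₀ = zero , 0<g₀
  ... | no 0≮g₀ = Product.map suc id (positive-term (g ∘ suc) 0<rest)
    where
    0<rest : 0ℤ < sum (g ∘ suc)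
    0<rest = ℤ.≰⇒> λ rest≤0 → ℤ.<⇒≱ 0<Σ (ℤ.+-mono-≤ (ℤ.≮⇒≥ 0≮g₀) rest≤0)

  +-sum : ∀ {n} (g : Fin n → ℕ) → + ℕΣ.sum g ≡ sum (λ i → + g i)
  +-sum {zero} g = refl
  +-sum {suc n} g = trans (ℤ.pos-+ (g zero) _) (cong (_+_ (+ g zero)) (+-sum (g ∘ suc)))

  ℕΣ-mono : ∀ {n} {g h : Fin n → ℕ} → (∀ i → g i ℕ.≤ h i) → ℕΣ.sum g ℕ.≤ ℕΣ.sum h
  ℕΣ-mono {zero} _ = ℕ.z≤n
  ℕΣ-mono {suc n} g≤h = ℕ.+-mono-≤ (g≤h zero) (ℕΣ-mono (g≤h ∘ suc))

  ℕΣ-mono-< : ∀ {n} {g h : Fin n → ℕ} → (∀ i → g i ℕ.≤ h i) → ∀ e → g e ℕ.< h e → ℕΣ.sum g ℕ.< ℕΣ.sum h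
  ℕΣ-mono-< g≤h zero g<h = ℕ.+-mono-<-≤ g<h (ℕΣ-mono (g≤h ∘ suc))
  ℕΣ-mono-< g≤h (suc e) g<h = ℕ.+-mono-≤-< (g≤h zero) (ℕΣ-mono-< (g≤h ∘ suc) e g<h)

  listSum-map-tabulate : ∀ {A : Set} {n} (f : Fin n → A) (g : A → ℕ) → ℕ.sum (map g (Data.List.tabulate f)) ≡ ℕΣ.sum (g ∘ f)
  listSum-map-tabulate {n = zero} f g = refl
  listSum-map-tabulate {n = suc n} f g = cong (g (f zero) ℕ.+_) (listSum-map-tabulate (f ∘ suc) g)

  ∣∣-sum : ∀ {n} (B : Subset n) → ∣ B ∣ ≡ ℕΣ.sum (λ i → if lookup B i then 1 else 0)
  ∣∣-sum [] = refl
  ∣∣-sum (true ∷ B) = cong suc (∣∣-sum B)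
  ∣∣-sum (false ∷ B) = ∣∣-sum B

  foldr-⊔-upper : ∀ {x} (xs : List ℤ) → x List.∈ xs → x ≤ foldr _⊔_ 0ℤ xs
  foldr-⊔-upper (y ∷ ys) (here refl) = ℤ.i≤i⊔j y _
  foldr-⊔-upper (y ∷ ys) (there x∈ys) = ℤ.≤-trans (foldr-⊔-upper ys x∈ys) (ℤ.i≤j⊔i y _)

  i≤j+[i-k]⇒k≤j : ∀ {a c x} → a ≤ x + (a - c) → c ≤ x
  i≤j+[i-k]⇒k≤j {a} {c} {x} a≤ = subst₂ _≤_ (left a c) (right x a c) (ℤ.+-monoˡ-≤ (c - a) a≤)
    where
    left : ∀ a c → a + (c - a) ≡ c
    left = solve-∀
    right : ∀ x a c → x + (a - c) + (c - a) ≡ x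
    right = solve-∀

  δ-diff-pos : ∀ {n} (x y u : Fin n) → 0ℤ < δ x u - δ y u → x ≡ u
  δ-diff-pos x y u pos with x ≟ u | y ≟ u
  δ-diff-pos x y u pos | yes x≡u | _ = x≡u
  δ-diff-pos x y u () | no _ | yes _
  δ-diff-pos x y u (+<+ ()) | no _ | no _

  false≢true : false ≢ true
  false≢true ()

  ind≡1 : ∀ {b} → ind b ≡ 1ℤ → b ≡ true
  ind≡1 {true} _ = refl

  *-suc-≤-+ : ∀ {x a b} r → x ℕ.≤ a → x ℕ.* suc r ℕ.≤ b → x ℕ.* suc (suc r) ℕ.≤ a ℕ.+ b
  *-suc-≤-+ {x} {a} {b} r x≤a x*≤b = subst (ℕ._≤ a ℕ.+ b) (sym (ℕ.*-suc x (suc r))) (ℕ.+-mono-≤ x≤a x*≤b)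

  i+j≤k⇒j≤k-i : ∀ {a b c} → a + b ≤ c → b ≤ c - a
  i+j≤k⇒j≤k-i {a} {b} {c} a+b≤c = subst (_≤ c - a) (cancel a b) (ℤ.+-monoˡ-≤ (- a) a+b≤c)
    where
    cancel : ∀ a b → a + b - a ≡ b
    cancel = solve-∀

  i≡j+k⇒i-j≡k : ∀ {i j k} → i ≡ j + k → i - j ≡ k
  i≡j+k⇒i-j≡k {j = j} {k} refl = cancel j k
    where
    cancel : ∀ j k → j + k - j ≡ k
    cancel = solve-∀

  +[1+r]≤i⇒i≡+[1+r′] : ∀ {r x} → + suc r ≤ x → ∃ λ r′ → x ≡ + suc r′ × r ℕ.≤ r′
  +[1+r]≤i⇒i≡+[1+r′] {x = + suc r′} (+≤+ (ℕ.s≤s r≤r′)) = r′ , refl , r≤r′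

  ∈-allSubsets : ∀ {m} (φ : Subset m) → φ List.∈ allSubsets m
  ∈-allSubsets [] = here refl
  ∈-allSubsets (true ∷ φ) = ∈-++⁺ˡ (∈-map⁺ (true ∷_) (∈-allSubsets φ))
  ∈-allSubsets (false ∷ φ) = ∈-++⁺ʳ _ (∈-map⁺ (false ∷_) (∈-allSubsets φ))

  ⊆ᵇ-sound : ∀ {m} {φ X : Subset m} → T (φ ⊆ᵇ X) → φ ⊆ X
  ⊆ᵇ-sound {φ = true ∷ _} {true ∷ _} _ here = here
  ⊆ᵇ-sound {φ = true ∷ _} {false ∷ _} () here
  ⊆ᵇ-sound {φ = _ ∷ _} {_ ∷ _} φ⊆ᵇX (there x∈φ) = there (⊆ᵇ-sound (proj₂ (Equivalence.to T-∧ φ⊆ᵇX)) x∈φ)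

  ⊆ᵇ-complete : ∀ {m} {φ X : Subset m} → φ ⊆ X → T (φ ⊆ᵇ X)
  ⊆ᵇ-complete {φ = []} {[]} _ = _
  ⊆ᵇ-complete {φ = false ∷ _} {_ ∷ _} φ⊆X = ⊆ᵇ-complete (drop-∷-⊆ φ⊆X)
  ⊆ᵇ-complete {φ = true ∷ _} {_ ∷ _} φ⊆X with φ⊆X here
  ... | here = ⊆ᵇ-complete (drop-∷-⊆ φ⊆X)

  ⊆-lookup : ∀ {m} {p q : Subset m} → (∀ i → lookup p i ≡ true → lookup q i ≡ true) → p ⊆ q
  ⊆-lookup {p = p} {q} p→q {i} i∈p = lookup⇒[]= i q (p→q i ([]=⇒lookup i∈p))

  lookup-∉ : ∀ {m} {p : Subset m} {i} → i ∉ p → lookup p i ≡ false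
  lookup-∉ {p = p} {i} i∉p with lookup p i in eq
  ... | true = ⊥-elim (i∉p (lookup⇒[]= i p eq))
  ... | false = refl

  and-allFin⁺ : ∀ {n} (g : Fin n → Bool) → T (and (map g (allFin n))) → ∀ i → T (g i)
  and-allFin⁺ {n} g h i = All.lookup (all⁺ g (allFin n) h) (∈-allFin i)

  and-allFin⁻ : ∀ {n} (g : Fin n → Bool) → (∀ i → T (g i)) → T (and (map g (allFin n)))
  and-allFin⁻ {n} g h = all⁻ g {allFin n} (All.tabulate λ {i} _ → h i)

  module Network (G : Digraph) (s t : Fin (Digraph.V G)) where
    open Digraph G
    open import Data.List.Membership.DecPropositional (_≟_ {E}) using (_∈?_)

    F : Subset E → ℤ
    F = f G s t

    incidence : Fin E → Fin V → ℤ
    incidence e v = δ (tail e) v - δ (head e) v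

    netOut : (Fin E → ℤ) → Fin V → ℤ
    netOut D v = sum λ e → D e * incidence e v

    -- A set of edges carrying one unit each is the flow χ φ; integer vectors D : Fin E → ℤ
    -- also represent differences of such flows.
    χ : Subset E → Fin E → ℤ
    χ φ e = ind (lookup φ e)

    netOut-cong : ∀ {D₁ D₂} → (∀ e → D₁ e ≡ D₂ e) → ∀ v → netOut D₁ v ≡ netOut D₂ v
    netOut-cong D₁≗D₂ v = sum-cong-≗ λ e → cong (_* incidence e v) (D₁≗D₂ e)

    netOut-zero : ∀ v → netOut (λ _ → 0ℤ) v ≡ 0ℤ
    netOut-zero v = sum-replicate-zero E

    netOut-+ : ∀ D₁ D₂ v → netOut (λ e → D₁ e + D₂ e) v ≡ netOut D₁ v + netOut D₂ v
    netOut-+ D₁ D₂ v = trans (sum-cong-≗ λ e → ℤ.*-distribʳ-+ (incidence e v) (D₁ e) (D₂ e)) (∑-distrib-+ (λ e → D₁ e * incidence e v) (λ e → D₂ e * incidence e v))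

    netOut-- : ∀ D₁ D₂ v → netOut (λ e → D₁ e - D₂ e) v ≡ netOut D₁ v - netOut D₂ v
    netOut-- D₁ D₂ v = trans (netOut-+ D₁ (λ e → - D₂ e) v) (cong (_+_ (netOut D₁ v)) neg)
      where
      neg : netOut (λ e → - D₂ e) v ≡ - netOut D₂ v
      neg = trans (sum-cong-≗ λ e → sym (ℤ.neg-distribˡ-* (D₂ e) (incidence e v))) (sum-neg (λ e → D₂ e * incidence e v))

    netOut-erase : ∀ D e v → netOut D v ≡ netOut (erase D e) v + D e * incidence e v
    netOut-erase D e v = trans (sum-erase _ e) (cong (_+ D e * incidence e v) (sum-cong-≗ erase-*))
      where
      erase-* : ∀ i → erase (λ i → D i * incidence i v) e i ≡ erase D e i * incidence i v
      erase-* i with does (i ≟ e)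
      ... | true = sym (ℤ.*-zeroˡ (incidence i v))
      ... | false = refl

    degrees-netOut : ∀ φ v → + outDeg G s t φ v - + inDeg G s t φ v ≡ netOut (χ φ) v
    degrees-netOut φ v = begin
        + outDeg G s t φ v - + inDeg G s t φ v
          ≡⟨ cong₂ (λ a b → + a - + b) (listSum-map-tabulate id (count tail)) (listSum-map-tabulate id (count head)) ⟩
        + ℕΣ.sum (count tail) - + ℕΣ.sum (count head)
          ≡⟨ cong₂ _-_ (+-sum (count tail)) (+-sum (count head)) ⟩
        sum (λ e → + count tail e) - sum (λ e → + count head e)
          ≡⟨ sym (trans (∑-distrib-+ (λ e → + count tail e) (λ e → - + count head e)) (cong (_+_ (sum (λ e → + count tail e))) (sum-neg (λ e → + count head e)))) ⟩
        sum (λ e → + count tail e - + count head e)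
          ≡⟨ sum-cong-≗ (λ e → count-incidence (lookup φ e) (tail e) (head e)) ⟩
        netOut (χ φ) v ∎
      where
      open ≡-Reasoning
      count : (Fin E → Fin V) → Fin E → ℕ
      count end e = if lookup φ e ∧ ⌊ end e ≟ v ⌋ then 1 else 0
      count-incidence : ∀ m x y → + (if m ∧ ⌊ x ≟ v ⌋ then 1 else 0) - + (if m ∧ ⌊ y ≟ v ⌋ then 1 else 0)
                                  ≡ ind m * (δ x v - δ y v)
      count-incidence m x y rewrite isYes≗does (x ≟ v) | isYes≗does (y ≟ v) with m | does (x ≟ v) | does (y ≟ v)
      ... | false | _ | _ = refl
      ... | true | true | true = refl
      ... | true | true | false = refl
      ... | true | false | true = refl
      ... | true | false | false = refl

    netOut-∅ : ∀ v → netOut (χ ∅) v ≡ 0ℤ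
    netOut-∅ v = trans (netOut-cong (λ e → cong ind (lookup-replicate e false)) v) (netOut-zero v)

    -- Flows and f

    record IsFlow (X φ : Subset E) : Set where
      field
        φ⊆X : φ ⊆ X
        conservation : ∀ v → v ≢ s → v ≢ t → netOut (χ φ) v ≡ 0ℤ

    open IsFlow

    balanced⇒netOut≡0 : ∀ φ v → T (inDeg G s t φ v ℕ.≡ᵇ outDeg G s t φ v) → netOut (χ φ) v ≡ 0ℤ
    balanced⇒netOut≡0 φ v balanced = begin
      netOut (χ φ) v                              ≡⟨ sym (degrees-netOut φ v) ⟩
      + outDeg G s t φ v - + inDeg G s t φ v      ≡⟨ cong (λ d → + outDeg G s t φ v - + d) (ℕ.≡ᵇ⇒≡ (inDeg G s t φ v) (outDeg G s t φ v) balanced) ⟩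
      + outDeg G s t φ v - + outDeg G s t φ v     ≡⟨ ℤ.+-inverseʳ (+ outDeg G s t φ v) ⟩
      0ℤ                                          ∎
      where open ≡-Reasoning

    netOut≡0⇒balanced : ∀ φ v → netOut (χ φ) v ≡ 0ℤ → T (inDeg G s t φ v ℕ.≡ᵇ outDeg G s t φ v)
    netOut≡0⇒balanced φ v netOut≡0 = ℕ.≡⇒≡ᵇ (inDeg G s t φ v) (outDeg G s t φ v)
      (sym (ℤ.+-injective (ℤ.i-j≡0⇒i≡j (+ outDeg G s t φ v) (+ inDeg G s t φ v) (trans (degrees-netOut φ v) netOut≡0))))

    conservedᵇ : Subset E → Fin V → Bool
    conservedᵇ φ v = ⌊ v ≟ s ⌋ ∨ ⌊ v ≟ t ⌋ ∨ (inDeg G s t φ v ℕ.≡ᵇ outDeg G s t φ v)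

    isFlow⇒IsFlow : ∀ {X φ} → T (isFlow G s t X φ) → IsFlow X φ
    isFlow⇒IsFlow {X} {φ} h = record { φ⊆X = ⊆ᵇ-sound capacity ; conservation = conserved }
      where
      capacity = proj₁ (Equivalence.to T-∧ h)
      conserved : ∀ v → v ≢ s → v ≢ t → netOut (χ φ) v ≡ 0ℤ
      conserved v v≢s v≢t with v ≟ s | v ≟ t | and-allFin⁺ (conservedᵇ φ) (proj₂ (Equivalence.to T-∧ h)) v
      ... | yes v≡s | _ | _ = ⊥-elim (v≢s v≡s)
      ... | no _ | yes v≡t | _ = ⊥-elim (v≢t v≡t)
      ... | no _ | no _ | holds = balanced⇒netOut≡0 φ v holds

    IsFlow⇒isFlow : ∀ {X φ} → IsFlow X φ → T (isFlow G s t X φ)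
    IsFlow⇒isFlow {X} {φ} fl = Equivalence.from T-∧ (⊆ᵇ-complete (φ⊆X fl) , and-allFin⁻ (conservedᵇ φ) conserved)
      where
      conserved : ∀ v → T (conservedᵇ φ v)
      conserved v with v ≟ s | v ≟ t
      ... | yes _ | _ = _
      ... | no _ | yes _ = _
      ... | no v≢s | no v≢t = netOut≡0⇒balanced φ v (conservation fl v v≢s v≢t)

    ∅-flow : ∀ X → IsFlow X ∅
    ∅-flow X = record { φ⊆X = ⊆-min X ; conservation = λ v _ _ → netOut-∅ v }

    flow≤F : ∀ {X φ} → IsFlow X φ → netOut (χ φ) s ≤ F X
    flow≤F {X} {φ} fl = subst (_≤ F X) (degrees-netOut φ s)
      (foldr-⊔-upper _ (∈-map⁺ (value G s t) (∈-filter⁺ (λ φ → T? (isFlow G s t X φ)) (∈-allSubsets φ) (IsFlow⇒isFlow fl))))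

    F-attained : ∀ X → ∃ λ φ → IsFlow X φ × netOut (χ φ) s ≡ F X
    F-attained X with foldr-selective ℤ.⊔-sel 0ℤ (map (value G s t) (filterᵇ (isFlow G s t X) (allSubsets E)))
    ... | inj₁ F≡0 = ∅ , ∅-flow X , trans (netOut-∅ s) (sym F≡0)
    ... | inj₂ F∈ with ∈-map⁻ (value G s t) F∈
    ...   | φ , φ∈ , F≡value = φ , isFlow⇒IsFlow (proj₂ (∈-filter⁻ (λ φ → T? (isFlow G s t X φ)) {xs = allSubsets E} φ∈))
                             , trans (sym (degrees-netOut φ s)) (sym F≡value)

    F-nonneg : ∀ X → 0ℤ ≤ F X
    F-nonneg X = subst (_≤ F X) (netOut-∅ s) (flow≤F (∅-flow X))

    F-mono : ∀ {X Y} → X ⊆ Y → F X ≤ F Y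
    F-mono {X} X⊆Y with F-attained X
    ... | φ , fl , value≡F = subst (_≤ _) value≡F (flow≤F (record { φ⊆X = X⊆Y ∘ φ⊆X fl ; conservation = conservation fl }))

    ∈-toSubset⁺ : ∀ {e l} → e List.∈ l → e ∈ toSubset G l
    ∈-toSubset⁺ (here refl) = x∈p∪q⁺ (inj₁ (x∈⁅x⁆ _))
    ∈-toSubset⁺ (there e∈l) = x∈p∪q⁺ (inj₂ (∈-toSubset⁺ e∈l))

    ∈-toSubset⁻ : ∀ {e} l → e ∈ toSubset G l → e List.∈ l
    ∈-toSubset⁻ [] e∈ = ⊥-elim (∉⊥ e∈)
    ∈-toSubset⁻ (x ∷ l) e∈ with x∈p∪q⁻ ⁅ x ⁆ (toSubset G l) e∈
    ... | inj₁ e∈⁅x⁆ = here (x∈⁅y⁆⇒x≡y x e∈⁅x⁆)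
    ... | inj₂ e∈l = there (∈-toSubset⁻ l e∈l)

    walk-suffix : ∀ {a b q e} → Walk G a b q → Unique q → e List.∈ q
                → ∃ λ ys → Walk G (head e) b ys × Unique (e ∷ ys) × ys ⊆ₗ q
    walk-suffix ((_ ∷ _) wk) uq (here refl) = _ , wk , uq , xs⊆x∷xs _ _
    walk-suffix ((_ ∷ _) wk) (_ ∷ uq) (there e∈q) with walk-suffix wk uq e∈q
    ... | ys , wys , uys , ys⊆q = ys , wys , uys , there ∘ ys⊆q

    trail : ∀ {u w p} → Walk G u w p → ∃ λ q → Walk G u w q × Unique q × q ⊆ₗ p
    trail [] = [] , [] , [] , λ ()
    trail ((e ∷ tail≡u) wk) with trail wk
    ... | q , wq , uq , q⊆p with e ∈? q
    ...   | no e∉q = e ∷ q , (e ∷ tail≡u) wq , ¬Any⇒All¬ q e∉q ∷ uq , ∷⁺ʳ e q⊆p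
    ...   | yes e∈q with walk-suffix wq uq e∈q
    ...     | ys , wys , uys , ys⊆q = e ∷ ys , (e ∷ tail≡u) wys , uys , ∷⁺ʳ e (q⊆p ∘ ys⊆q)

    netOut-trail : ∀ {u w q} → Walk G u w q → Unique q → ∀ v → netOut (χ (toSubset G q)) v ≡ δ u v - δ w v
    netOut-trail {u} [] _ v = trans (netOut-∅ v) (sym (ℤ.+-inverseʳ (δ u v)))
    netOut-trail {u} {w} {e ∷ q} ((e ∷ tail≡u) wk) (e∉q ∷ uq) v = begin
      netOut (χ (toSubset G (e ∷ q))) v
        ≡⟨ netOut-erase _ e v ⟩
      netOut (erase (χ (toSubset G (e ∷ q))) e) v + χ (toSubset G (e ∷ q)) e * incidence e v
        ≡⟨ cong₂ _+_ (netOut-cong erase-first v) (trans (cong (_* incidence e v) χ-first) (ℤ.*-identityˡ _)) ⟩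
      netOut (χ (toSubset G q)) v + incidence e v
        ≡⟨ cong (_+ incidence e v) (netOut-trail wk uq v) ⟩
      δ (head e) v - δ w v + (δ (tail e) v - δ (head e) v)
        ≡⟨ telescope (δ (head e) v) (δ w v) (δ (tail e) v) ⟩
      δ (tail e) v - δ w v
        ≡⟨ cong (λ x → δ x v - δ w v) tail≡u ⟩
      δ u v - δ w v ∎
      where
      open ≡-Reasoning
      telescope : ∀ a b c → a - b + (c - a) ≡ c - b
      telescope = solve-∀
      lookup-first : ∀ e′ → lookup (toSubset G (e ∷ q)) e′ ≡ lookup ⁅ e ⁆ e′ ∨ lookup (toSubset G q) e′
      lookup-first e′ = lookup-zipWith _∨_ e′ ⁅ e ⁆ (toSubset G q)
      χ-first : χ (toSubset G (e ∷ q)) e ≡ 1ℤ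
      χ-first = cong ind (trans (lookup-first e) (cong (_∨ lookup (toSubset G q) e) ([]=⇒lookup (x∈⁅x⁆ e))))
      erase-first : ∀ e′ → erase (χ (toSubset G (e ∷ q))) e e′ ≡ χ (toSubset G q) e′
      erase-first e′ with e′ ≟ e
      ... | yes refl = sym (cong ind (lookup-∉ (All¬⇒¬Any e∉q ∘ ∈-toSubset⁻ q)))
      ... | no e′≢e = cong ind (trans (lookup-first e′) (cong (_∨ lookup (toSubset G q) e′) (lookup-∉ (x≢y⇒x∉⁅y⁆ e′≢e))))

    unit-flow : s ≢ t → ∀ {p} → Walk G s t p → 1ℤ ≤ F (toSubset G p)
    unit-flow s≢t {p} wk with trail wk
    ... | q , wq , uq , q⊆p = subst (_≤ F (toSubset G p)) q-value (flow≤F q-flow)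
      where
      q-flow : IsFlow (toSubset G p) (toSubset G q)
      q-flow = record
        { φ⊆X = ∈-toSubset⁺ ∘ q⊆p ∘ ∈-toSubset⁻ q
        ; conservation = λ v v≢s v≢t → trans (netOut-trail wq uq v) (cong₂ _-_ (δ-≢ (v≢s ∘ sym)) (δ-≢ (v≢t ∘ sym)))
        }
      q-value : netOut (χ (toSubset G q)) s ≡ 1ℤ
      q-value = trans (netOut-trail wq uq s) (cong₂ _-_ (δ-refl s) (δ-≢ (s≢t ∘ sym)))

    -- Extracting paths and walks from flow differences

    Ternary : (Fin E → ℤ) → Set
    Ternary D = ∀ e → D e ≡ 0ℤ ⊎ D e ≡ 1ℤ ⊎ D e ≡ -1ℤ

    ZeroOne : (Fin E → ℤ) → Set
    ZeroOne D = ∀ e → D e ≡ 0ℤ ⊎ D e ≡ 1ℤ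

    _⊑_ : (Fin E → ℤ) → (Fin E → ℤ) → Set
    P ⊑ D = ∀ e → P e ≡ 0ℤ ⊎ P e ≡ D e

    weight : (Fin E → ℤ) → ℕ
    weight D = ℕΣ.sum λ e → ∣ D e ∣ℤ

    ExcessAt : (Fin E → ℤ) → Fin V → Set
    ExcessAt D u = ∀ v → v ≢ t → δ u v ≤ netOut D v

    record Arc (D : Fin E → ℤ) (u : Fin V) : Set where
      field
        edge : Fin E
        target : Fin V
        unit : ∣ D edge ∣ℤ ≡ 1
        netOut-edge : ∀ v → D edge * incidence edge v ≡ δ u v - δ target v
        forward : D edge ≡ 1ℤ → tail edge ≡ u × head edge ≡ target

    find-arc : ∀ {D u} → Ternary D → u ≢ t → ExcessAt D u → Arc D u
    find-arc {D} {u} D± u≢t excess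
      with positive-term (λ e → D e * incidence e u) (ℤ.suc[i]≤j⇒i<j (subst (_≤ netOut D u) (δ-refl u) (excess u u≢t)))
    ... | e , pos with D± e
    ...   | inj₁ D≡0 = ⊥-elim (ℤ.<-irrefl refl (subst (0ℤ <_) (trans (cong (_* incidence e u) D≡0) (ℤ.*-zeroˡ (incidence e u))) pos))
    ...   | inj₂ (inj₁ D≡1) = record
      { edge = e ; target = head e ; unit = cong ∣_∣ℤ D≡1
      ; netOut-edge = λ v → trans (scaled v) (cong (λ x → δ x v - δ (head e) v) tail≡u)
      ; forward = λ _ → tail≡u , refl
      }
      where
      scaled : ∀ v → D e * incidence e v ≡ incidence e v
      scaled v = trans (cong (_* incidence e v) D≡1) (ℤ.*-identityˡ _)
      tail≡u : tail e ≡ u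
      tail≡u = δ-diff-pos (tail e) (head e) u (subst (0ℤ <_) (scaled u) pos)
    ...   | inj₂ (inj₂ D≡-1) = record
      { edge = e ; target = tail e ; unit = cong ∣_∣ℤ D≡-1
      ; netOut-edge = λ v → trans (reversed v) (cong (λ x → δ x v - δ (tail e) v) head≡u)
      ; forward = λ D≡1 → ⊥-elim (-1≢1 (trans (sym D≡-1) D≡1))
      }
      where
      -1≢1 : -1ℤ ≢ 1ℤ
      -1≢1 ()
      negate-diff : ∀ a b → -1ℤ * (a - b) ≡ b - a
      negate-diff = solve-∀
      reversed : ∀ v → D e * incidence e v ≡ δ (head e) v - δ (tail e) v
      reversed v = trans (cong (_* incidence e v) D≡-1) (negate-diff (δ (tail e) v) (δ (head e) v))
      head≡u : head e ≡ u
      head≡u = δ-diff-pos (head e) (tail e) u (subst (0ℤ <_) (reversed u) pos)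

    module _ {D u} (a : Arc D u) where
      open Arc a

      weight-erase : weight (erase D edge) ℕ.< weight D
      weight-erase = ℕΣ-mono-< erase-≤ edge (subst₂ ℕ._<_ (sym (cong ∣_∣ℤ (erase-self D edge))) (sym unit) (ℕ.s≤s ℕ.z≤n))
        where
        erase-≤ : ∀ e → ∣ erase D edge e ∣ℤ ℕ.≤ ∣ D e ∣ℤ
        erase-≤ e with does (e ≟ edge)
        ... | true = ℕ.z≤n
        ... | false = ℕ.≤-refl

      excess-erase : ExcessAt D u → ExcessAt (erase D edge) target
      excess-erase excess v v≢t =
        i≤j+[i-k]⇒k≤j (subst (δ u v ≤_) (trans (netOut-erase D edge v) (cong (_+_ (netOut (erase D edge) v)) (netOut-edge v))) (excess v v≢t))

      prepend-arc : ∀ {P} → P ⊑ erase D edge → (∀ v → netOut P v ≡ δ target v - δ t v)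
                  → ∃ λ P′ → P′ ⊑ D × ∀ v → netOut P′ v ≡ δ u v - δ t v
      prepend-arc {P} P⊑ P-net = (λ e → (D e - erase D edge e) + P e) , extended⊑D , extended-net
        where
        extended⊑D : ∀ e → D e - erase D edge e + P e ≡ 0ℤ ⊎ D e - erase D edge e + P e ≡ D e
        extended⊑D e with e ≟ edge | P⊑ e
        ... | yes refl | P≡0 = inj₂ (trans (cong (_+_ (D e + 0ℤ)) (reduce P≡0)) (trans (ℤ.+-identityʳ _) (ℤ.+-identityʳ _)))
        ... | no _ | inj₁ P≡0 = inj₁ (cong₂ _+_ (ℤ.+-inverseʳ (D e)) P≡0)
        ... | no _ | inj₂ P≡D = inj₂ (trans (cong (_+ P e) (ℤ.+-inverseʳ (D e))) (trans (ℤ.+-identityˡ _) P≡D))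
        extended-net : ∀ v → netOut (λ e → D e - erase D edge e + P e) v ≡ δ u v - δ t v
        extended-net v = begin
          netOut (λ e → D e - erase D edge e + P e) v
            ≡⟨ netOut-+ (λ e → D e - erase D edge e) P v ⟩
          netOut (λ e → D e - erase D edge e) v + netOut P v
            ≡⟨ cong₂ _+_ (trans (netOut-- D (erase D edge) v) (i≡j+k⇒i-j≡k (netOut-erase D edge v))) (P-net v) ⟩
          D edge * incidence edge v + (δ target v - δ t v)
            ≡⟨ cong (_+ (δ target v - δ t v)) (netOut-edge v) ⟩
          δ u v - δ target v + (δ target v - δ t v)
            ≡⟨ telescope (δ u v) (δ target v) (δ t v) ⟩
          δ u v - δ t v ∎
          where
          open ≡-Reasoning
          telescope : ∀ a b c → a - b + (b - c) ≡ a - c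
          telescope = solve-∀

    arc-forward : ∀ {D u} → ZeroOne D → (a : Arc D u) → D (Arc.edge a) ≡ 1ℤ
    arc-forward D01 a with D01 (Arc.edge a)
    ... | inj₁ D≡0 = ⊥-elim (0≢1 (trans (sym (cong ∣_∣ℤ D≡0)) (Arc.unit a)))
      where
      0≢1 : 0 ≢ 1
      0≢1 ()
    ... | inj₂ D≡1 = D≡1

    -- Follow arcs of D from u, erasing each arc used so that the excess moves to its other end;
    -- the weight of D bounds the number of steps.
    extract-path : ∀ n {D u} → weight D ℕ.< n → Ternary D → ExcessAt D u
            → ∃ λ P → P ⊑ D × ∀ v → netOut P v ≡ δ u v - δ t v
    extract-path (suc n) {D} {u} w<n D± excess with u ≟ t
    ... | yes refl = (λ _ → 0ℤ) , (λ _ → inj₁ refl) , λ v → trans (netOut-zero v) (sym (ℤ.+-inverseʳ (δ u v)))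
    ... | no u≢t with find-arc D± u≢t excess
    ...   | a with extract-path n {erase D (Arc.edge a)} {Arc.target a} (ℕ.<-≤-trans (weight-erase a) (ℕ.s≤s⁻¹ w<n)) (erase-ternary (Arc.edge a)) (excess-erase a excess)
      where
      erase-ternary : ∀ e → Ternary (erase D e)
      erase-ternary e e′ with does (e′ ≟ e)
      ... | true = inj₁ refl
      ... | false = D± e′
    ...     | P , P⊑ , P-net = prepend-arc a P⊑ P-net

    extract-walk : ∀ n {D u} → weight D ℕ.< n → ZeroOne D → ExcessAt D u
            → ∃ λ q → Walk G u t q × length q ℕ.≤ weight D
    extract-walk (suc n) {D} {u} w<n D01 excess with u ≟ t
    ... | yes refl = [] , [] , ℕ.z≤n
    ... | no u≢t with find-arc (λ e → Data.Sum.map₂ inj₁ (D01 e)) u≢t excess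
    ...   | a with extract-walk n {erase D (Arc.edge a)} {Arc.target a} (ℕ.<-≤-trans (weight-erase a) (ℕ.s≤s⁻¹ w<n)) (erase-zeroOne (Arc.edge a)) (excess-erase a excess)
      where
      erase-zeroOne : ∀ e → ZeroOne (erase D e)
      erase-zeroOne e e′ with does (e′ ≟ e)
      ... | true = inj₁ refl
      ... | false = D01 e′
    ...     | q , wq , |q|≤ =
      let tail≡u , head≡target = Arc.forward a (arc-forward D01 a)
      in Arc.edge a ∷ q , (Arc.edge a ∷ tail≡u) (subst (λ x → Walk G x t q) (sym head≡target) wq) , ℕ.≤-<-trans |q|≤ (weight-erase a)

    source-excess : ∀ {D} → 1ℤ ≤ netOut D s → (∀ v → v ≢ s → v ≢ t → netOut D v ≡ 0ℤ) → ExcessAt D s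
    source-excess {D} 1≤D-s D-cons v v≢t with s ≟ v
    ... | yes refl = 1≤D-s
    ... | no s≢v = ℤ.≤-reflexive (sym (D-cons v (s≢v ∘ sym) v≢t))

    χ-zeroOne : ∀ φ → ZeroOne (χ φ)
    χ-zeroOne φ e with lookup φ e
    ... | true = inj₂ refl
    ... | false = inj₁ refl

    weight-χ : ∀ φ → weight (χ φ) ≡ ∣ φ ∣
    weight-χ φ = sym (trans (∣∣-sum φ) (ℕΣ.sum-cong-≗ λ e → ∣ind∣ (lookup φ e)))
      where
      ∣ind∣ : ∀ b → (if b then 1 else 0) ≡ ∣ ind b ∣ℤ
      ∣ind∣ true = refl
      ∣ind∣ false = refl

    walk-within : ∀ {B} → 1ℤ ≤ F B → ∃ λ q → Walk G s t q × length q ℕ.≤ ∣ B ∣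
    walk-within {B} 1≤F with F-attained B
    ... | φ , fl , φ-value =
      let excess = source-excess {χ φ} (subst (1ℤ ≤_) (sym φ-value) 1≤F) (conservation fl)
          q , q-walk , |q|≤ = extract-walk (suc (weight (χ φ))) {χ φ} {s} ℕ.≤-refl (χ-zeroOne φ) excess
      in q , q-walk , ℕ.≤-trans |q|≤ (subst (ℕ._≤ ∣ B ∣) (sym (weight-χ φ)) (p⊆q⇒∣p∣≤∣q∣ (φ⊆X fl)))

    -- Augmentation

    -- D only adds edges missing from ψ and only removes edges of ψ, so ψ ⊕ D is again a set.
    Residual : Subset E → (Fin E → ℤ) → Set
    Residual ψ D = ∀ e → D e ≡ 0ℤ ⊎ (D e ≡ 1ℤ × lookup ψ e ≡ false) ⊎ (D e ≡ -1ℤ × lookup ψ e ≡ true)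

    residual⇒ternary : ∀ {ψ D} → Residual ψ D → Ternary D
    residual⇒ternary res e = Data.Sum.map₂ (Data.Sum.map proj₁ proj₁) (res e)

    residual-⊑ : ∀ {ψ D P} → Residual ψ D → P ⊑ D → Residual ψ P
    residual-⊑ res P⊑D e with P⊑D e
    ... | inj₁ P≡0 = inj₁ P≡0
    ... | inj₂ P≡D rewrite P≡D = res e

    rest-⊑ : ∀ {D P} → P ⊑ D → (λ e → D e - P e) ⊑ D
    rest-⊑ {D} P⊑D e with P⊑D e
    ... | inj₁ P≡0 = inj₂ (trans (cong (_-_ (D e)) P≡0) (ℤ.+-identityʳ (D e)))
    ... | inj₂ P≡D = inj₁ (trans (cong (_-_ (D e)) P≡D) (ℤ.+-inverseʳ (D e)))

    difference-residual : ∀ φ ψ → Residual ψ (λ e → χ φ e - χ ψ e)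
    difference-residual φ ψ e with lookup φ e | lookup ψ e
    ... | true | true = inj₁ refl
    ... | false | false = inj₁ refl
    ... | true | false = inj₂ (inj₁ (refl , refl))
    ... | false | true = inj₂ (inj₂ (refl , refl))

    _⊕_ : Subset E → (Fin E → ℤ) → Subset E
    ψ ⊕ P = Vec.tabulate λ e → does (χ ψ e + P e ≟ℤ 1ℤ)

    χ-⊕ : ∀ {ψ P} → Residual ψ P → ∀ e → χ (ψ ⊕ P) e ≡ χ ψ e + P e
    χ-⊕ {ψ} {P} res e = trans (cong ind (lookup∘tabulate _ e)) (shift (lookup ψ e) (P e) (res e))
      where
      shift : ∀ b p → p ≡ 0ℤ ⊎ (p ≡ 1ℤ × b ≡ false) ⊎ (p ≡ -1ℤ × b ≡ true) → ind (does (ind b + p ≟ℤ 1ℤ)) ≡ ind b + p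
      shift true _ (inj₁ refl) = refl
      shift false _ (inj₁ refl) = refl
      shift false _ (inj₂ (inj₁ (refl , refl))) = refl
      shift true _ (inj₂ (inj₂ (refl , refl))) = refl

    _⁺∖_ : (Fin E → ℤ) → Subset E → Subset E
    P ⁺∖ C = Vec.tabulate λ e → does (P e ≟ℤ 1ℤ) ∧ not (lookup C e)

    ⁺∖-lookup : ∀ P C e → lookup (P ⁺∖ C) e ≡ does (P e ≟ℤ 1ℤ) ∧ not (lookup C e)
    ⁺∖-lookup P C e = lookup∘tabulate _ e

    ⁺∖-disjoint : ∀ {P C} e → e ∈ P ⁺∖ C → e ∉ C
    ⁺∖-disjoint {P} {C} e e∈ e∈C = false≢true (begin
      false                                   ≡⟨ sym (∧-zeroʳ _) ⟩
      does (P e ≟ℤ 1ℤ) ∧ not true             ≡⟨ cong (λ b → does (P e ≟ℤ 1ℤ) ∧ not b) (sym ([]=⇒lookup e∈C)) ⟩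
      does (P e ≟ℤ 1ℤ) ∧ not (lookup C e)     ≡⟨ sym (⁺∖-lookup P C e) ⟩
      lookup (P ⁺∖ C) e                       ≡⟨ []=⇒lookup e∈ ⟩
      true                                    ∎)
      where open ≡-Reasoning

    ⁺∖-⊆ : ∀ {D} C {X} → (∀ e → D e ≡ 1ℤ → lookup X e ≡ true) → D ⁺∖ C ⊆ X
    ⁺∖-⊆ {D} C {X} D≡1⇒X = ⊆-lookup λ e e∈ → D≡1⇒X e (positive e (trans (sym (⁺∖-lookup D C e)) e∈))
      where
      positive : ∀ e → does (D e ≟ℤ 1ℤ) ∧ not (lookup C e) ≡ true → D e ≡ 1ℤ
      positive e _ with D e ≟ℤ 1ℤ
      positive e _ | yes D≡1 = D≡1
      positive e () | no _

    ∣⁺∖∣-split : ∀ {P D} C → P ⊑ D → ∣ D ⁺∖ C ∣ ≡ ∣ P ⁺∖ C ∣ ℕ.+ ∣ (λ e → D e - P e) ⁺∖ C ∣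
    ∣⁺∖∣-split {P} {D} C P⊑D = begin
      ∣ D ⁺∖ C ∣                                              ≡⟨ ∣⁺∖∣-sum D ⟩
      ℕΣ.sum (count D)                                        ≡⟨ ℕΣ.sum-cong-≗ split ⟩
      ℕΣ.sum (λ e → count P e ℕ.+ count (λ e → D e - P e) e)  ≡⟨ ℕΣ.∑-distrib-+ (count P) (count (λ e → D e - P e)) ⟩
      ℕΣ.sum (count P) ℕ.+ ℕΣ.sum (count (λ e → D e - P e))   ≡⟨ sym (cong₂ ℕ._+_ (∣⁺∖∣-sum P) (∣⁺∖∣-sum (λ e → D e - P e))) ⟩
      ∣ P ⁺∖ C ∣ ℕ.+ ∣ (λ e → D e - P e) ⁺∖ C ∣               ∎
      where
      open ≡-Reasoning
      count : (Fin E → ℤ) → Fin E → ℕ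
      count Q e = if does (Q e ≟ℤ 1ℤ) ∧ not (lookup C e) then 1 else 0
      ∣⁺∖∣-sum : ∀ Q → ∣ Q ⁺∖ C ∣ ≡ ℕΣ.sum (count Q)
      ∣⁺∖∣-sum Q = trans (∣∣-sum (Q ⁺∖ C)) (ℕΣ.sum-cong-≗ λ e → cong (λ b → if b then 1 else 0) (⁺∖-lookup Q C e))
      split : ∀ e → count D e ≡ count P e ℕ.+ count (λ e → D e - P e) e
      split e with P⊑D e
      ... | inj₁ P≡0 rewrite P≡0 | ℤ.+-identityʳ (D e) = refl
      ... | inj₂ P≡D rewrite P≡D | ℤ.+-inverseʳ (D e) = sym (ℕ.+-identityʳ _)

    ⊕-⊆ : ∀ {C ψ P} → IsFlow C ψ → Residual ψ P → ψ ⊕ P ⊆ C ∪ P ⁺∖ C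
    ⊕-⊆ {C} {ψ} {P} fl res = ⊆-lookup λ e e∈ → trans (lookup-zipWith _∨_ e C (P ⁺∖ C)) (covered e e∈)
      where
      in-C : ∀ e → lookup ψ e ≡ true → lookup C e ≡ true
      in-C e ψe = []=⇒lookup (φ⊆X fl (lookup⇒[]= e ψ ψe))
      kept : ∀ e → lookup (ψ ⊕ P) e ≡ true → P e ≡ 0ℤ → lookup ψ e ≡ true
      kept e e∈ P≡0 = ind≡1 (begin
        χ ψ e            ≡⟨ sym (ℤ.+-identityʳ _) ⟩
        χ ψ e + 0ℤ       ≡⟨ cong (_+_ (χ ψ e)) (sym P≡0) ⟩
        χ ψ e + P e      ≡⟨ sym (χ-⊕ {ψ} {P} res e) ⟩
        χ (ψ ⊕ P) e      ≡⟨ cong ind e∈ ⟩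
        1ℤ               ∎)
        where open ≡-Reasoning
      covered : ∀ e → lookup (ψ ⊕ P) e ≡ true → lookup C e ∨ lookup (P ⁺∖ C) e ≡ true
      covered e e∈ with lookup C e in C-e
      ... | true = refl
      ... | false rewrite ⁺∖-lookup P C e | C-e with res e
      ...   | inj₁ P≡0 = ⊥-elim (false≢true (trans (sym C-e) (in-C e (kept e e∈ P≡0))))
      ...   | inj₂ (inj₁ (P≡1 , _)) rewrite P≡1 = refl
      ...   | inj₂ (inj₂ (_ , ψ-e)) = ⊥-elim (false≢true (trans (sym C-e) (in-C e ψ-e)))

    module _ (s≢t : s ≢ t) where

      augment : ∀ {C ψ P} → IsFlow C ψ → Residual ψ P → (∀ v → netOut P v ≡ δ s v - δ t v)
              → netOut (χ ψ) s + 1ℤ ≤ F (C ∪ P ⁺∖ C)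
      augment {C} {ψ} {P} fl res P-net = subst (_≤ F (C ∪ P ⁺∖ C)) increased (flow≤F augmented)
        where
        netOut-⊕ : ∀ v → netOut (χ (ψ ⊕ P)) v ≡ netOut (χ ψ) v + (δ s v - δ t v)
        netOut-⊕ v = trans (netOut-cong (χ-⊕ {ψ} {P} res) v) (trans (netOut-+ (χ ψ) P v) (cong (_+_ (netOut (χ ψ) v)) (P-net v)))
        augmented : IsFlow (C ∪ P ⁺∖ C) (ψ ⊕ P)
        augmented = record
          { φ⊆X = ⊕-⊆ {C} {ψ} {P} fl res
          ; conservation = λ v v≢s v≢t →
              trans (netOut-⊕ v) (cong₂ _+_ (conservation fl v v≢s v≢t) (cong₂ _-_ (δ-≢ (v≢s ∘ sym)) (δ-≢ (v≢t ∘ sym))))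
          }
        increased : netOut (χ (ψ ⊕ P)) s ≡ netOut (χ ψ) s + 1ℤ
        increased = trans (netOut-⊕ s) (cong (_+_ (netOut (χ ψ) s)) (cong₂ _-_ (δ-refl s) (δ-≢ (s≢t ∘ sym))))

      unit-value : ∀ {P} → (∀ v → netOut P v ≡ δ s v - δ t v) → netOut P s ≡ 1ℤ
      unit-value P-net = trans (P-net s) (cong₂ _-_ (δ-refl s) (δ-≢ (s≢t ∘ sym)))

      -- D splits into r + 1 residual s-t paths whose forward edges outside C are disjoint parts
      -- of D ⁺∖ C; the path with the fewest of them yields B.
      cheap-augmentation : ∀ r {C ψ D} → IsFlow C ψ → Residual ψ D
        → netOut D s ≡ + suc r → (∀ v → v ≢ s → v ≢ t → netOut D v ≡ 0ℤ)
        → ∃ λ B → (∀ e → e ∈ B → e ∉ C) × netOut (χ ψ) s + 1ℤ ≤ F (C ∪ B) × ∣ B ∣ ℕ.* suc r ℕ.≤ ∣ D ⁺∖ C ∣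
      cheap-augmentation r {C} {ψ} {D} fl res D-s D-cons
        with extract-path (suc (weight D)) {D} {s} ℕ.≤-refl (residual⇒ternary {ψ} res) (source-excess {D} (subst (1ℤ ≤_) (sym D-s) (+≤+ (ℕ.s≤s ℕ.z≤n))) D-cons)
      cheap-augmentation zero {C} {ψ} {D} fl res D-s D-cons | P , P⊑D , P-net =
        P ⁺∖ C , ⁺∖-disjoint {P} {C} , augment {C} {ψ} {P} fl (residual-⊑ {ψ} {D} {P} res P⊑D) P-net ,
        subst₂ ℕ._≤_ (sym (ℕ.*-identityʳ ∣ P ⁺∖ C ∣)) (sym (∣⁺∖∣-split {P} {D} C P⊑D)) (ℕ.m≤m+n _ _)
      cheap-augmentation (suc r) {C} {ψ} {D} fl res D-s D-cons | P , P⊑D , P-net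
        with cheap-augmentation r {C} {ψ} {λ e → D e - P e} fl (residual-⊑ {ψ} {D} res (rest-⊑ {D} {P} P⊑D)) rest-s rest-cons
        where
        rest-s : netOut (λ e → D e - P e) s ≡ + suc r
        rest-s = trans (netOut-- D P s) (cong₂ _-_ D-s (unit-value {P} P-net))
        rest-cons : ∀ v → v ≢ s → v ≢ t → netOut (λ e → D e - P e) v ≡ 0ℤ
        rest-cons v v≢s v≢t = trans (netOut-- D P v)
          (cong₂ _-_ (D-cons v v≢s v≢t) (trans (P-net v) (cong₂ _-_ (δ-≢ (v≢s ∘ sym)) (δ-≢ (v≢t ∘ sym)))))
      ... | B , B-disjoint , B-gain , B-cost with ∣ P ⁺∖ C ∣ ℕ.≤? ∣ B ∣
      ...   | yes P≤B = P ⁺∖ C , ⁺∖-disjoint {P} {C} , augment {C} {ψ} {P} fl (residual-⊑ {ψ} {D} {P} res P⊑D) P-net ,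
        subst (_ ℕ.≤_) (sym (∣⁺∖∣-split {P} {D} C P⊑D)) (*-suc-≤-+ r ℕ.≤-refl (ℕ.≤-trans (ℕ.*-monoˡ-≤ (suc r) P≤B) B-cost))
      ...   | no P≰B = B , B-disjoint , B-gain ,
        subst (_ ℕ.≤_) (sym (∣⁺∖∣-split {P} {D} C P⊑D)) (*-suc-≤-+ r (ℕ.<⇒≤ (ℕ.≰⇒> P≰B)) B-cost)

      augmentation-bound : ∀ r {C X} → F C + + suc r ≤ F X
        → ∃ λ B → (∀ e → e ∈ B → e ∉ C) × F C + 1ℤ ≤ F (C ∪ B) × ∣ B ∣ ℕ.* suc r ℕ.≤ ∣ X ∣
      augmentation-bound r {C} {X} gap with F-attained X | F-attained C
      ... | φ , φ-flow , φ-value | ψ , ψ-flow , ψ-value with +[1+r]≤i⇒i≡+[1+r′] (subst (+ suc r ≤_) (sym D-s) (i+j≤k⇒j≤k-i gap))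
        where
        D-s : netOut (λ e → χ φ e - χ ψ e) s ≡ F X - F C
        D-s = trans (netOut-- (χ φ) (χ ψ) s) (cong₂ _-_ φ-value ψ-value)
      ... | r′ , D-s , r≤r′ with cheap-augmentation r′ ψ-flow (difference-residual φ ψ) D-s D-cons
        where
        D-cons : ∀ v → v ≢ s → v ≢ t → netOut (λ e → χ φ e - χ ψ e) v ≡ 0ℤ
        D-cons v v≢s v≢t = trans (netOut-- (χ φ) (χ ψ) v) (cong₂ _-_ (conservation φ-flow v v≢s v≢t) (conservation ψ-flow v v≢s v≢t))
      ... | B , B-disjoint , B-gain , B-cost =
        B , B-disjoint , subst (λ x → x + 1ℤ ≤ F (C ∪ B)) ψ-value B-gain ,
        ℕ.≤-trans (ℕ.*-monoʳ-≤ ∣ B ∣ (ℕ.s≤s r≤r′)) (ℕ.≤-trans B-cost (p⊆q⇒∣p∣≤∣q∣ (⁺∖-⊆ {λ e → χ φ e - χ ψ e} C {X} forward-in-X)))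
        where
        forward-in-X : ∀ e → χ φ e - χ ψ e ≡ 1ℤ → lookup X e ≡ true
        forward-in-X e D≡1 with lookup φ e in φ-e | lookup ψ e
        ... | true | _ = []=⇒lookup (φ⊆X φ-flow (lookup⇒[]= e φ φ-e))
        forward-in-X e () | false | true
        forward-in-X e () | false | false

import Data.Nat as ℕ
import Data.Integer as ℤ
open import Data.Integer using (+_)

module Competitiveness
  (G : Digraph) (s t : Fin (Digraph.V G)) (s≢t : s ≢ t)
  (ord : List (Fin (Digraph.E G))) (k : ℕ)
  (X : Subset (Digraph.E G)) (∣X∣≤k : ∣ X ∣ ℕ.≤ k)
  (counterexample : + 2 ℤ.* f G s t (SA G ord k) ℤ.< f G s t X)
  where

  open import Data.Nat using (_+_; _*_; _≤_; _<_; z≤n; s≤s)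
  import Data.Nat.Properties as ℕ
  import Data.Integer.Properties as ℤ
  open import Data.List.Properties using (length-++; ++-assoc)
  open import Data.List.Relation.Binary.Permutation.Propositional using (_↭_; ↭-sym)
  open import Data.List.Relation.Binary.Permutation.Propositional.Properties using (∈-resp-↭; ↭-length)
  open Digraph G
  open FlowTheory.Network G s t using (F; F-nonneg; F-mono; unit-flow; walk-within; augmentation-bound; ∈-toSubset⁺; ∈-toSubset⁻)

  w : ℕ
  w = ℤ.∣ F (SA G ord k) ∣

  F-SA : F (SA G ord k) ≡ + w
  F-SA = sym (ℤ.0≤i⇒+∣i∣≡i (F-nonneg (SA G ord k)))

  F-X : F X ≡ + ℤ.∣ F X ∣
  F-X = sym (ℤ.0≤i⇒+∣i∣≡i (F-nonneg X))

  2w<F-X : 2 * w < ℤ.∣ F X ∣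
  2w<F-X = ℤ.drop‿+<+ (subst₂ ℤ._<_ (trans (cong (+ 2 ℤ.*_) F-SA) (sym (ℤ.pos-* 2 w))) F-X counterexample)

  F≤w : ∀ {C} → C ⊆ SA G ord k → F C ℤ.≤ + w
  F≤w {C} C⊆SA = subst (F C ℤ.≤_) F-SA (F-mono C⊆SA)

  X-beyond : ¬ F X ℤ.≤ + w
  X-beyond F-X≤w = ℕ.<⇒≱ 2w<F-X (ℕ.≤-trans (ℤ.drop‿+≤+ (subst (ℤ._≤ + w) F-X F-X≤w)) (ℕ.m≤m+n w (w + 0)))

  IncrementCost : Subset E → ℕ → Set
  IncrementCost C ℓ = ∀ B → (∀ e → e ∈ B → e ∉ C) → F C ℤ.+ + 1 ℤ.≤ F (C ∪ B) → ℓ ≤ ∣ B ∣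

  block-cost : ∀ {C ℓ} → C ⊆ SA G ord k → IncrementCost C ℓ → ℓ * suc w ≤ ∣ X ∣
  block-cost {C} C⊆SA cost =
    let B , B-disjoint , B-gain , B-cost = augmentation-bound s≢t w gap
    in ℕ.≤-trans (ℕ.*-monoˡ-≤ (suc w) (cost B B-disjoint B-gain)) B-cost
    where
    w+suc-w≤ : w + suc w ≤ ℤ.∣ F X ∣
    w+suc-w≤ = subst (_≤ ℤ.∣ F X ∣) (trans (cong suc (cong (_+_ w) (ℕ.+-identityʳ w))) (sym (ℕ.+-suc w w))) 2w<F-X
    gap : F C ℤ.+ + suc w ℤ.≤ F X
    gap = subst (F C ℤ.+ + suc w ℤ.≤_) (sym F-X) (ℤ.≤-trans (ℤ.+-monoˡ-≤ (+ suc w) (F≤w C⊆SA)) (ℤ.+≤+ w+suc-w≤))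

  ∈-take-++ : ∀ {A : Set} {e : A} L z {n} → e List.∈ L → length L ≤ n → e List.∈ take n (L ++ z)
  ∈-take-++ (x ∷ L) z {suc n} (here e≡x) _ = here e≡x
  ∈-take-++ (x ∷ L) z {suc n} (there e∈L) (s≤s |L|≤n) = there (∈-take-++ L z e∈L |L|≤n)

  prefix⊆SA : ∀ {L z} → ord ≡ L ++ z → length L ≤ k → toSubset G L ⊆ SA G ord k
  prefix⊆SA {L} {z} ord≡ |L|≤k e∈L =
    ∈-toSubset⁺ (subst (λ o → _ List.∈ take k o) (sym ord≡) (∈-take-++ L z (∈-toSubset⁻ L e∈L) |L|≤k))

  record Progress (C : Subset E) (L : List (Fin E)) (c : ℕ) : Set where
    field
      covered : C ⊆ toSubset G L
      short : length L ≤ k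
      F≥c : + c ℤ.≤ F C
      cost : length L * suc w ≤ c * ∣ X ∣

  advance : ∀ {C L c C′ b z} → Progress C L c → ord ≡ (L ++ b) ++ z
          → C′ ⊆ toSubset G (L ++ b) → + suc c ℤ.≤ F C′ → IncrementCost C (length b)
          → Progress C′ (L ++ b) (suc c)
  advance {C} {L} {c} {C′} {b} {z} progress ord≡ C′⊆ C′-value b-cost =
    record { covered = C′⊆ ; short = short′ ; F≥c = C′-value ; cost = cost′ }
    where
    open Progress progress
    C⊆SA : C ⊆ SA G ord k
    C⊆SA = prefix⊆SA {L} {b ++ z} (trans ord≡ (++-assoc L b z)) short ∘ covered
    cost′ : length (L ++ b) * suc w ≤ suc c * ∣ X ∣
    cost′ = begin
      length (L ++ b) * suc w                 ≡⟨ cong (_* suc w) (length-++ L) ⟩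
      (length L + length b) * suc w           ≡⟨ ℕ.*-distribʳ-+ (suc w) (length L) (length b) ⟩
      length L * suc w + length b * suc w     ≤⟨ ℕ.+-mono-≤ cost (block-cost C⊆SA b-cost) ⟩
      c * ∣ X ∣ + ∣ X ∣                       ≡⟨ ℕ.+-comm (c * ∣ X ∣) ∣ X ∣ ⟩
      suc c * ∣ X ∣                           ∎
      where open ℕ.≤-Reasoning
    c≤w : c ≤ w
    c≤w = ℤ.drop‿+≤+ (ℤ.≤-trans F≥c (F≤w C⊆SA))
    -- c ≤ w turns cost′ into length (L ++ b) ≤ ∣ X ∣.
    short′ : length (L ++ b) ≤ k
    short′ = ℕ.≤-trans (ℕ.*-cancelʳ-≤ (length (L ++ b)) ∣ X ∣ (suc w)
      (ℕ.≤-trans cost′ (ℕ.≤-trans (ℕ.*-monoˡ-≤ ∣ X ∣ (s≤s c≤w)) (ℕ.≤-reflexive (ℕ.*-comm (suc w) ∣ X ∣))))) ∣X∣≤k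

  run : ∀ {C L c bs rest} → Progress C L c → ord ≡ L ++ concat bs ++ rest → Increments G s t C bs → ⊥
  run {C} {L} progress ord≡ (stop F-C≡F-⊤) =
    X-beyond (ℤ.≤-trans (F-mono ⊆⊤) (subst (ℤ._≤ + w) F-C≡F-⊤ (F≤w (prefix⊆SA {L} ord≡ short ∘ covered))))
    where open Progress progress
  run {C} {L} {c} {_ ∷ bs} {rest} progress ord≡ (step b _ _ gain minimal increments) =
    run (advance progress ord≡′ covered′ value′ minimal) ord≡′ increments
    where
    open Progress progress
    ord≡′ : ord ≡ (L ++ b) ++ concat bs ++ rest
    ord≡′ = trans ord≡ (trans (cong (_++_ L) (++-assoc b (concat bs) rest)) (sym (++-assoc L b (concat bs ++ rest))))
    covered′ : C ∪ toSubset G b ⊆ toSubset G (L ++ b)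
    covered′ e∈ with x∈p∪q⁻ C (toSubset G b) e∈
    ... | inj₁ e∈C = ∈-toSubset⁺ (∈-++⁺ˡ (∈-toSubset⁻ L (covered e∈C)))
    ... | inj₂ e∈b = ∈-toSubset⁺ (∈-++⁺ʳ L (∈-toSubset⁻ b e∈b))
    value′ : + suc c ℤ.≤ F (C ∪ toSubset G b)
    value′ = ℤ.≤-trans (subst (ℤ._≤ F C ℤ.+ + 1) (cong +_ (ℕ.+-comm c 1)) (ℤ.+-monoˡ-≤ (+ 1) F≥c)) gain

  start : ∀ {p b₀ z} → ShortestPath G s t p → b₀ ↭ p → ord ≡ b₀ ++ z → Progress (toSubset G p) b₀ 1
  start {p} {b₀} (p-walk , shortest) b₀↭p ord≡ =
    advance {L = []} initial ord≡ (∈-toSubset⁺ ∘ ∈-resp-↭ (↭-sym b₀↭p) ∘ ∈-toSubset⁻ p) (unit-flow s≢t p-walk) b₀-cost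
    where
    initial : Progress ∅ [] 0
    initial = record { covered = ⊆-min _ ; short = z≤n ; F≥c = F-nonneg ∅ ; cost = z≤n }
    b₀-cost : IncrementCost ∅ (length b₀)
    b₀-cost B _ gain =
      let q , q-walk , |q|≤∣B∣ = walk-within (ℤ.≤-trans (ℤ.+-monoˡ-≤ (+ 1) (F-nonneg ∅)) (subst (λ Y → F ∅ ℤ.+ + 1 ℤ.≤ F Y) (∪-identityˡ B) gain))
      in ℕ.≤-trans (ℕ.≤-reflexive (↭-length b₀↭p)) (ℕ.≤-trans (shortest q q-walk) |q|≤∣B∣)

  refuted : QuickestIncrement G s t ord → ⊥
  refuted (_ , p , b₀ , bs , rest , p-shortest , b₀↭p , increments , ord≡) =
    run (start p-shortest b₀↭p ord≡) ord≡ increments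

open import Data.Nat using (ℕ; _≤_)
open import Data.Integer as ℤ using (+_; _*_)
import Data.Integer.Properties as ℤ
open import Data.Fin using (Fin)
open import Data.Fin.Subset using (Subset; ∣_∣)
open import Data.List using (List)
open import Data.Product using (∃)
open import Relation.Binary.PropositionalEquality using (_≢_)

theorem4 : (G : Digraph) → Simple G → (s t : Fin (Digraph.V G)) → s ≢ t
    → ∃ (λ p → Walk G s t p)
    → (ord : List (Fin (Digraph.E G))) → QuickestIncrement G s t ord
    → (k : ℕ) → 1 ≤ k → k ≤ Digraph.E G
    → (X : Subset (Digraph.E G)) → ∣ X ∣ ≤ k
    → f G s t X ℤ.≤ + 2 * f G s t (SA G ord k)
theorem4 G _ s t s≢t _ ord quickest k _ _ X ∣X∣≤k =
  ℤ.≮⇒≥ λ counterexample → Competitiveness.refuted G s t s≢t ord k X ∣X∣≤k counterexample quickest
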